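{- Let $X$ be a finite non-empty set and $a,b,r\in 2^X$, identified with their indicator vectors in $\mathbb{R}^{|X|}$. Define $z:=(|r|+|b|)\,a-(|r|+|a|)\,b\in\mathbb{R}^{|X|}$ and $\langle r,z\rangle:=\sum_{x\in X}r(x)z(x)$. If $\mathrm{Jac}(a,r)=\mathrm{Jac}(b,r)$ then $\langle r,z\rangle=0$. Conversely, if $r\neq\emptyset$ and $\langle r,z\rangle=0$ then $\mathrm{Jac}(a,r)=\mathrm{Jac}(b,r)$.
   Context: For a finite set $X$, $2^X$ is its power set; each $a\in 2^X$ is identified with the vector $a\in\{0,1\}^{X}$ with $a(x)=1$ iff $x\in a$. The Jaccard distance on $2^X$ is $\mathrm{Jac}(a,b)=|a\,\Delta\, b|/|a\cup b|$ for $a\neq b$ and $\mathrm{Jac}(a,a)=0$, where $\Delta$ is symmetric difference. -}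

module Defs where

open import Data.Nat using (ℕ; zero; suc)
open import Data.Integer using (ℤ; +_; _-_; _*_)
open import Data.Rational using (ℚ; 0ℚ; _/_)
open import Data.Bool using (Bool; true; false; if_then_else_)
import Data.Bool.Properties as BoolP
open import Data.Fin using (Fin)
open import Data.Fin.Subset using (Subset; _∪_; _─_; ∣_∣)
open import Data.Vec using (lookup; tabulate)
open import Data.Vec.Properties using (≡-dec)
import Data.Vec.Functional as VF
open import Data.Vec.Functional using (Vector)
open import Relation.Nullary using (yes; no)

_Δ_ : ∀ {n} → Subset n → Subset n → Subset n
a Δ b = (a ─ b) ∪ (b ─ a)

-- Jaccard distance, valued in ℚ.  Jac a a = 0; for a ≠ b, |a Δ b| / |a ∪ b|
-- (a ≠ b forces |a ∪ b| ≥ 1; the zero branch is unreachable).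
Jac : ∀ {n} → Subset n → Subset n → ℚ
Jac {n} a b with ≡-dec BoolP._≟_ a b
... | yes _ = 0ℚ
... | no _ with ∣ a ∪ b ∣
...   | zero = 0ℚ
...   | suc k = (+ ∣ a Δ b ∣) / suc k

ind : ∀ {n} → Subset n → Vector ℤ n
ind a x = if lookup a x then + 1 else + 0

zvec : ∀ {n} → Subset n → Subset n → Subset n → Vector ℤ n
zvec a b r x = (+ (∣ r ∣ Data.Nat.+ ∣ b ∣)) * ind a x - (+ (∣ r ∣ Data.Nat.+ ∣ a ∣)) * ind b x

inner : ∀ {n} → Vector ℤ n → Vector ℤ n → ℤ
inner u v = VF.foldr Data.Integer._+_ (+ 0) (λ x → u x * v x)

{-# OPTIONS --safe #-}
-- Write x = |a Δ r|, i = |a ∩ r| and y = |b Δ r|, j = |b ∩ r|.  Then |a ∪ r| = x + i and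
-- |r| + |a| = |a ∪ r| + |a ∩ r| = x + 2i, so
--   ⟨r, z⟩ = (y + 2j) i − (x + 2i) j = y i − x j,
-- while for r ≠ ∅ both unions are non-empty and Jac a r = Jac b r, i.e. x / (x + i) = y / (y + j),
-- cross-multiplies to x (y + j) = y (x + i), i.e. again x j = y i.  If r = ∅ then ind r = 0, so
-- ⟨r, z⟩ = 0 outright.

module Submission where

open import Defs
open import Data.Nat using (ℕ; zero; suc; _≤_)
import Data.Nat as ℕ
open import Data.Nat.Properties using (+-comm; +-suc; +-cancelˡ-≡; n≤0⇒n≡0)
import Data.Nat.Tactic.RingSolver as ℕ-Solver
open import Data.Integer using (ℤ; +_; _+_; _-_; _*_)
open import Data.Integer.Properties using (+-injective; pos-*; i-j≡0⇒i≡j; i≡j⇒i-j≡0)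
import Data.Integer.Tactic.RingSolver as ℤ-Solver
open import Data.Rational using (_/_)
open import Data.Rational.Properties using (0/n≡0; normalize-injective-≃; fromℚᵘ-cong)
open import Data.Rational.Unnormalised using (mkℚᵘ; *≡*)
import Data.Bool.Properties as Bool
open import Data.Vec using ([]; _∷_)
open import Data.Vec.Properties using (≡-dec)
open import Data.Vec.Functional using (Vector; head; tail)
open import Data.Fin.Subset using (Subset; ⊥; _∪_; _∩_; ∣_∣; inside; outside)
open import Data.Fin.Subset.Properties using (∩-comm; q⊆p∪q; p⊆q⇒∣p∣≤∣q∣)
open import Data.Product using (_×_; _,_)
open import Function using (_∘_)
open import Function.Bundles using (_⇔_; mk⇔; Equivalence)
open import Function.Properties.Equivalence using () renaming (trans to ⇔-trans)
open import Relation.Nullary using (yes; no; contradiction)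
open import Relation.Binary.PropositionalEquality

∣p∣≡0⇒p≡⊥ : ∀ {n} {p : Subset n} → ∣ p ∣ ≡ 0 → p ≡ ⊥
∣p∣≡0⇒p≡⊥ {p = []}          _  = refl
∣p∣≡0⇒p≡⊥ {p = outside ∷ p} eq = cong (outside ∷_) (∣p∣≡0⇒p≡⊥ eq)
∣p∣≡0⇒p≡⊥ {p = inside  ∷ p} ()

∣p∪q∣≡0⇒q≡⊥ : ∀ {n} (p q : Subset n) → ∣ p ∪ q ∣ ≡ 0 → q ≡ ⊥
∣p∪q∣≡0⇒q≡⊥ p q eq = ∣p∣≡0⇒p≡⊥ (n≤0⇒n≡0 (subst (∣ q ∣ ≤_) eq (p⊆q⇒∣p∣≤∣q∣ (q⊆p∪q p q))))

∣pΔp∣≡0 : ∀ {n} (p : Subset n) → ∣ p Δ p ∣ ≡ 0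
∣pΔp∣≡0 []            = refl
∣pΔp∣≡0 (outside ∷ p) = ∣pΔp∣≡0 p
∣pΔp∣≡0 (inside ∷ p)  = ∣pΔp∣≡0 p

∣p∪q∣≡∣pΔq∣+∣p∩q∣ : ∀ {n} (p q : Subset n) → ∣ p ∪ q ∣ ≡ ∣ p Δ q ∣ ℕ.+ ∣ p ∩ q ∣
∣p∪q∣≡∣pΔq∣+∣p∩q∣ []            []            = refl
∣p∪q∣≡∣pΔq∣+∣p∩q∣ (inside ∷ p)  (inside ∷ q)  = trans (cong suc (∣p∪q∣≡∣pΔq∣+∣p∩q∣ p q)) (sym (+-suc _ _))
∣p∪q∣≡∣pΔq∣+∣p∩q∣ (inside ∷ p)  (outside ∷ q) = cong suc (∣p∪q∣≡∣pΔq∣+∣p∩q∣ p q)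
∣p∪q∣≡∣pΔq∣+∣p∩q∣ (outside ∷ p) (inside ∷ q)  = cong suc (∣p∪q∣≡∣pΔq∣+∣p∩q∣ p q)
∣p∪q∣≡∣pΔq∣+∣p∩q∣ (outside ∷ p) (outside ∷ q) = ∣p∪q∣≡∣pΔq∣+∣p∩q∣ p q

∣p∣+∣q∣≡∣p∪q∣+∣p∩q∣ : ∀ {n} (p q : Subset n) → ∣ p ∣ ℕ.+ ∣ q ∣ ≡ ∣ p ∪ q ∣ ℕ.+ ∣ p ∩ q ∣
∣p∣+∣q∣≡∣p∪q∣+∣p∩q∣ []            []            = refl
∣p∣+∣q∣≡∣p∪q∣+∣p∩q∣ (inside ∷ p)  (inside ∷ q)  =
  cong suc (trans (+-suc _ _) (trans (cong suc (∣p∣+∣q∣≡∣p∪q∣+∣p∩q∣ p q)) (sym (+-suc _ _))))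
∣p∣+∣q∣≡∣p∪q∣+∣p∩q∣ (inside ∷ p)  (outside ∷ q) = cong suc (∣p∣+∣q∣≡∣p∪q∣+∣p∩q∣ p q)
∣p∣+∣q∣≡∣p∪q∣+∣p∩q∣ (outside ∷ p) (inside ∷ q)  = trans (+-suc _ _) (cong suc (∣p∣+∣q∣≡∣p∪q∣+∣p∩q∣ p q))
∣p∣+∣q∣≡∣p∪q∣+∣p∩q∣ (outside ∷ p) (outside ∷ q) = ∣p∣+∣q∣≡∣p∪q∣+∣p∩q∣ p q

∣q∣+∣p∣≡∣pΔq∣+∣p∩q∣+∣p∩q∣ : ∀ {n} (p q : Subset n) →
  ∣ q ∣ ℕ.+ ∣ p ∣ ≡ ∣ p Δ q ∣ ℕ.+ ∣ p ∩ q ∣ ℕ.+ ∣ p ∩ q ∣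
∣q∣+∣p∣≡∣pΔq∣+∣p∩q∣+∣p∩q∣ p q = begin
  ∣ q ∣ ℕ.+ ∣ p ∣                         ≡⟨ +-comm ∣ q ∣ ∣ p ∣ ⟩
  ∣ p ∣ ℕ.+ ∣ q ∣                         ≡⟨ ∣p∣+∣q∣≡∣p∪q∣+∣p∩q∣ p q ⟩
  ∣ p ∪ q ∣ ℕ.+ ∣ p ∩ q ∣                 ≡⟨ cong (ℕ._+ ∣ p ∩ q ∣) (∣p∪q∣≡∣pΔq∣+∣p∩q∣ p q) ⟩
  ∣ p Δ q ∣ ℕ.+ ∣ p ∩ q ∣ ℕ.+ ∣ p ∩ q ∣   ∎
  where open ≡-Reasoning

cancel-common-summand : ∀ {s t k m n : ℕ} → s ≡ k ℕ.+ m → t ≡ k ℕ.+ n → (s ≡ t) ⇔ (m ≡ n)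
cancel-common-summand refl refl = mk⇔ (+-cancelˡ-≡ _ _ _) (cong (_ ℕ.+_))

m*[n+q]≡n*[m+p]⇔m*q≡n*p : ∀ m n p q →
  (m ℕ.* (n ℕ.+ q) ≡ n ℕ.* (m ℕ.+ p)) ⇔ (m ℕ.* q ≡ n ℕ.* p)
m*[n+q]≡n*[m+p]⇔m*q≡n*p m n p q = cancel-common-summand (expandˡ m n q) (expandʳ m n p)
  where
  expandˡ : ∀ m n q → m ℕ.* (n ℕ.+ q) ≡ m ℕ.* n ℕ.+ m ℕ.* q
  expandˡ = ℕ-Solver.solve-∀
  expandʳ : ∀ m n p → n ℕ.* (m ℕ.+ p) ≡ m ℕ.* n ℕ.+ n ℕ.* p
  expandʳ = ℕ-Solver.solve-∀

[n+q+q]*p≡[m+p+p]*q⇔m*q≡n*p : ∀ m n p q →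
  ((n ℕ.+ q ℕ.+ q) ℕ.* p ≡ (m ℕ.+ p ℕ.+ p) ℕ.* q) ⇔ (m ℕ.* q ≡ n ℕ.* p)
[n+q+q]*p≡[m+p+p]*q⇔m*q≡n*p m n p q =
  ⇔-trans (cancel-common-summand (expandˡ n p q) (expandʳ m p q)) (mk⇔ sym sym)
  where
  expandˡ : ∀ n p q → (n ℕ.+ q ℕ.+ q) ℕ.* p ≡ 2 ℕ.* p ℕ.* q ℕ.+ n ℕ.* p
  expandˡ = ℕ-Solver.solve-∀
  expandʳ : ∀ m p q → (m ℕ.+ p ℕ.+ p) ℕ.* q ≡ 2 ℕ.* p ℕ.* q ℕ.+ m ℕ.* q
  expandʳ = ℕ-Solver.solve-∀

+m-+n≡0⇔m≡n : ∀ m n → (+ m - + n ≡ + 0) ⇔ (m ≡ n)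
+m-+n≡0⇔m≡n m n = mk⇔ (+-injective ∘ i-j≡0⇒i≡j (+ m) (+ n)) (i≡j⇒i-j≡0 ∘ cong (+_))

+m/[1+k]≡+n/[1+l]⇔m*[1+l]≡n*[1+k] : ∀ m n k l →
  (+ m / suc k ≡ + n / suc l) ⇔ (m ℕ.* suc l ≡ n ℕ.* suc k)
+m/[1+k]≡+n/[1+l]⇔m*[1+l]≡n*[1+k] m n k l = mk⇔
  (normalize-injective-≃ m n (suc k) (suc l))
  (λ eq → fromℚᵘ-cong {mkℚᵘ (+ m) k} {mkℚᵘ (+ n) l}
     (*≡* (trans (sym (pos-* m (suc l))) (trans (cong +_ eq) (pos-* n (suc k))))))

Jac-unfold : ∀ {n} (a r : Subset n) {k} → ∣ a ∪ r ∣ ≡ suc k → Jac a r ≡ + ∣ a Δ r ∣ / suc k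
Jac-unfold a r {k} eq with ≡-dec Bool._≟_ a r
... | yes refl rewrite ∣pΔp∣≡0 a = sym (0/n≡0 (suc k))
... | no _ rewrite eq = refl

Jac≡Jac⇔cross-∪ : ∀ {n} (a b r : Subset n) → r ≢ ⊥ →
  (Jac a r ≡ Jac b r) ⇔ (∣ a Δ r ∣ ℕ.* ∣ b ∪ r ∣ ≡ ∣ b Δ r ∣ ℕ.* ∣ a ∪ r ∣)
Jac≡Jac⇔cross-∪ a b r r≢⊥ with ∣ a ∪ r ∣ in ∣a∪r∣≡ | ∣ b ∪ r ∣ in ∣b∪r∣≡
... | zero  | _     = contradiction (∣p∪q∣≡0⇒q≡⊥ a r ∣a∪r∣≡) r≢⊥
... | suc _ | zero  = contradiction (∣p∪q∣≡0⇒q≡⊥ b r ∣b∪r∣≡) r≢⊥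
... | suc k | suc l rewrite Jac-unfold a r ∣a∪r∣≡ | Jac-unfold b r ∣b∪r∣≡ =
  +m/[1+k]≡+n/[1+l]⇔m*[1+l]≡n*[1+k] (∣ a Δ r ∣) (∣ b Δ r ∣) k l

Jac≡Jac⇔cross-∩ : ∀ {n} (a b r : Subset n) → r ≢ ⊥ →
  (Jac a r ≡ Jac b r) ⇔ (∣ a Δ r ∣ ℕ.* ∣ b ∩ r ∣ ≡ ∣ b Δ r ∣ ℕ.* ∣ a ∩ r ∣)
Jac≡Jac⇔cross-∩ a b r r≢⊥ = ⇔-trans (Jac≡Jac⇔cross-∪ a b r r≢⊥) cross-∪⇔cross-∩
  where
  cross-∪⇔cross-∩ : (∣ a Δ r ∣ ℕ.* ∣ b ∪ r ∣ ≡ ∣ b Δ r ∣ ℕ.* ∣ a ∪ r ∣)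
                  ⇔ (∣ a Δ r ∣ ℕ.* ∣ b ∩ r ∣ ≡ ∣ b Δ r ∣ ℕ.* ∣ a ∩ r ∣)
  cross-∪⇔cross-∩ rewrite ∣p∪q∣≡∣pΔq∣+∣p∩q∣ a r | ∣p∪q∣≡∣pΔq∣+∣p∩q∣ b r =
    m*[n+q]≡n*[m+p]⇔m*q≡n*p (∣ a Δ r ∣) (∣ b Δ r ∣) (∣ a ∩ r ∣) (∣ b ∩ r ∣)

inner-ind : ∀ {n} (p q : Subset n) → inner (ind p) (ind q) ≡ + ∣ p ∩ q ∣
inner-ind []      []      = refl
inner-ind (s ∷ p) (t ∷ q) rewrite inner-ind p q with s | t
... | inside  | inside  = refl
... | inside  | outside = refl
... | outside | inside  = refl
... | outside | outside = refl

inner-⊥ˡ : ∀ {n} (v : Vector ℤ n) → inner (ind ⊥) v ≡ + 0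
inner-⊥ˡ {zero}  v = refl
inner-⊥ˡ {suc n} v = cong (_+_ (+ 0)) (inner-⊥ˡ (tail v))

inner-linearʳ : ∀ {n} (u v w : Vector ℤ n) (c d : ℤ) →
  inner u (λ i → c * v i - d * w i) ≡ c * inner u v - d * inner u w
inner-linearʳ {zero}  u v w c d = zero-linear c d
  where
  zero-linear : ∀ c d → + 0 ≡ c * + 0 - d * + 0
  zero-linear = ℤ-Solver.solve-∀
inner-linearʳ {suc n} u v w c d = begin
  u₀ * (c * v₀ - d * w₀) + inner (tail u) (λ i → c * tail v i - d * tail w i)
    ≡⟨ cong (_+_ (u₀ * (c * v₀ - d * w₀))) (inner-linearʳ (tail u) (tail v) (tail w) c d) ⟩
  u₀ * (c * v₀ - d * w₀) + (c * Σv - d * Σw)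
    ≡⟨ head-linear u₀ v₀ w₀ Σv Σw c d ⟩
  c * (u₀ * v₀ + Σv) - d * (u₀ * w₀ + Σw)
    ∎
  where
  open ≡-Reasoning
  u₀ v₀ w₀ Σv Σw : ℤ
  u₀ = head u
  v₀ = head v
  w₀ = head w
  Σv = inner (tail u) (tail v)
  Σw = inner (tail u) (tail w)
  head-linear : ∀ x y z s t c d → x * (c * y - d * z) + (c * s - d * t) ≡ c * (x * y + s) - d * (x * z + t)
  head-linear = ℤ-Solver.solve-∀

inner-zvec : ∀ {n} (a b r : Subset n) →
  inner (ind r) (zvec a b r)
    ≡ + ((∣ r ∣ ℕ.+ ∣ b ∣) ℕ.* ∣ a ∩ r ∣) - + ((∣ r ∣ ℕ.+ ∣ a ∣) ℕ.* ∣ b ∩ r ∣)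
inner-zvec a b r = begin
  inner (ind r) (zvec a b r)
    ≡⟨ inner-linearʳ (ind r) (ind a) (ind b) (+ A) (+ B) ⟩
  + A * inner (ind r) (ind a) - + B * inner (ind r) (ind b)
    ≡⟨ cong₂ (λ i j → + A * i - + B * j) (inner-ind r a) (inner-ind r b) ⟩
  + A * + ∣ r ∩ a ∣ - + B * + ∣ r ∩ b ∣
    ≡⟨ cong₂ (λ s t → + A * + ∣ s ∣ - + B * + ∣ t ∣) (∩-comm r a) (∩-comm r b) ⟩
  + A * + ∣ a ∩ r ∣ - + B * + ∣ b ∩ r ∣
    ≡⟨ cong₂ _-_ (pos-* A ∣ a ∩ r ∣) (pos-* B ∣ b ∩ r ∣) ⟨
  + (A ℕ.* ∣ a ∩ r ∣) - + (B ℕ.* ∣ b ∩ r ∣)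
    ∎
  where
  open ≡-Reasoning
  A B : ℕ
  A = ∣ r ∣ ℕ.+ ∣ b ∣
  B = ∣ r ∣ ℕ.+ ∣ a ∣

inner-zvec≡0⇔cross-∩ : ∀ {n} (a b r : Subset n) →
  (inner (ind r) (zvec a b r) ≡ + 0) ⇔ (∣ a Δ r ∣ ℕ.* ∣ b ∩ r ∣ ≡ ∣ b Δ r ∣ ℕ.* ∣ a ∩ r ∣)
inner-zvec≡0⇔cross-∩ a b r
  rewrite inner-zvec a b r | ∣q∣+∣p∣≡∣pΔq∣+∣p∩q∣+∣p∩q∣ a r | ∣q∣+∣p∣≡∣pΔq∣+∣p∩q∣+∣p∩q∣ b r =
  ⇔-trans (+m-+n≡0⇔m≡n _ _)
          ([n+q+q]*p≡[m+p+p]*q⇔m*q≡n*p (∣ a Δ r ∣) (∣ b Δ r ∣) (∣ a ∩ r ∣) (∣ b ∩ r ∣))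

lemma2 : (n : ℕ) → 1 ≤ n → (a b r : Subset n) →
    (Jac a r ≡ Jac b r → inner (ind r) (zvec a b r) ≡ + 0)
    × (r ≢ ⊥ → inner (ind r) (zvec a b r) ≡ + 0 → Jac a r ≡ Jac b r)
lemma2 n _ a b r = fwd , bwd
  where
  open Equivalence
  fwd : Jac a r ≡ Jac b r → inner (ind r) (zvec a b r) ≡ + 0
  fwd eq with ≡-dec Bool._≟_ r ⊥
  ... | yes refl = inner-⊥ˡ (zvec a b ⊥)
  ... | no r≢⊥  = from (inner-zvec≡0⇔cross-∩ a b r) (to (Jac≡Jac⇔cross-∩ a b r r≢⊥) eq)
  bwd : r ≢ ⊥ → inner (ind r) (zvec a b r) ≡ + 0 → Jac a r ≡ Jac b r
  bwd r≢⊥ = from (Jac≡Jac⇔cross-∩ a b r r≢⊥) ∘ to (inner-zvec≡0⇔cross-∩ a b r)
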